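{- Let $G=(X,Y,E)$ be a connected chain graph whose proper ordered chain partition $X_1,\dots,X_k$, $Y_1,\dots,Y_k$ has $k\ge 3$, and suppose that $X$ contains at most one pendent vertex and $Y$ contains at most one pendent vertex. If $|X|=3$ or $|Y|=3$, then $\gamma_{cs}(G)=3$; otherwise $\gamma_{cs}(G)=4$.
   Context: All graphs are finite, simple, undirected, without isolated vertices. A set $S$ of vertices is a cosecure dominating set if every vertex outside $S$ has a neighbour in $S$ and for every $u\in S$ there is a neighbour $v\notin S$ of $u$ such that $(S\setminus\{u\})\cup\{v\}$ is still dominating; $\gamma_{cs}(G)$ is the minimum size of a cosecure dominating set. A pendent vertex is a vertex of degree $1$. A bipartite graph $G=(X,Y,E)$ is a chain graph if $X$ can be ordered $x_1,\dots,x_{n_1}$ with $N(x_1)\subseteq\cdots\subseteq N(x_{n_1})$. Partition $X$ into classes of the relation $x\sim x'\iff N(x)=N(x')$, indexed $X_1,\dots,X_k$ so that $N(X_1)\subsetneq\cdots\subsetneq N(X_k)$ ($N(X_i)$ the common neighbourhood of $X_i$). Set $Y_1=N(X_1)$ and $Y_i=N(X_i)\setminus\bigcup_{j<i}N(X_j)$ for $i\ge2$; this is the proper ordered chain partition. -}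

module Defs where

open import Data.Nat using (ℕ; _≤_; _+_)
open import Data.Bool using (Bool; true; false; T; if_then_else_)
import Data.Bool.Properties as BoolP
open import Data.Fin using (Fin) renaming (_≤_ to _≤ᶠ_)
import Data.Fin as Fin
open import Data.Fin.Subset using (Subset; ∣_∣)
open import Data.Vec using (Vec; tabulate)
import Data.Vec.Properties as VecP
open import Data.List using (List; length; map; deduplicate)
open import Data.List.Base using (allFin)
open import Data.Sum using (_⊎_; inj₁; inj₂)
import Data.Sum.Properties as SumP
open import Data.Product using (Σ; ∃; _×_; _,_)
open import Data.Empty using (⊥)
open import Function.Bundles using (_↔_; Inverse)
open import Relation.Nullary using (¬_; yes; no; Dec)
open import Relation.Binary.PropositionalEquality using (_≡_)
open import Relation.Binary.Construct.Closure.ReflexiveTransitive using (Star)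

-- A bipartite graph G = (X, Y, E) with X = Fin p, Y = Fin q and
-- edge relation E x y (x ∈ X, y ∈ Y).  Simple and undirected by construction.

Vtx : ℕ → ℕ → Set
Vtx p q = Fin p ⊎ Fin q

module _ {p q : ℕ} (E : Fin p → Fin q → Bool) where

  Adj : Vtx p q → Vtx p q → Set
  Adj (inj₁ x) (inj₂ y) = T (E x y)
  Adj (inj₂ y) (inj₁ x) = T (E x y)
  Adj (inj₁ _) (inj₁ _) = ⊥
  Adj (inj₂ _) (inj₂ _) = ⊥

  Connected : Set
  Connected = ∀ u v → Star Adj u v

  NX : Fin p → Subset q
  NX x = tabulate (E x)

  NY : Fin q → Subset p
  NY y = tabulate (λ x → E x y)

  degX : Fin p → ℕ
  degX x = ∣ NX x ∣

  degY : Fin q → ℕ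
  degY y = ∣ NY y ∣

  IsChainGraph : Set
  IsChainGraph = Σ (Fin p ↔ Fin p) λ σ →
    ∀ i j → i ≤ᶠ j → ∀ y → T (E (Inverse.to σ i) y) → T (E (Inverse.to σ j) y)

  -- k = number of classes of X under x ~ x' iff N(x) = N(x'),
  -- i.e. the number of distinct neighbourhoods of X-vertices
  numClasses : ℕ
  numClasses = length (deduplicate (VecP.≡-dec BoolP._≟_) (map NX (allFin p)))

  AtMostOnePendentX : Set
  AtMostOnePendentX = ∀ x x' → degX x ≡ 1 → degX x' ≡ 1 → x ≡ x'

  AtMostOnePendentY : Set
  AtMostOnePendentY = ∀ y y' → degY y ≡ 1 → degY y' ≡ 1 → y ≡ y'

  VSet : Set
  VSet = Vtx p q → Bool

  size : VSet → ℕ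
  size S = ∣ tabulate (λ x → S (inj₁ x)) ∣ + ∣ tabulate (λ y → S (inj₂ y)) ∣

  _≟V_ : (u v : Vtx p q) → Dec (u ≡ v)
  _≟V_ = SumP.≡-dec Fin._≟_ Fin._≟_

  swap : VSet → Vtx p q → Vtx p q → VSet
  swap S u v w with w ≟V v
  ... | yes _ = true
  ... | no _ with w ≟V u
  ...   | yes _ = false
  ...   | no _ = S w

  Dominating : VSet → Set
  Dominating S = ∀ v → ¬ T (S v) → ∃ λ u → T (S u) × Adj v u

  CosecureDominating : VSet → Set
  CosecureDominating S =
    Dominating S ×
    (∀ u → T (S u) → ∃ λ v → Adj u v × ¬ T (S v) × Dominating (swap S u v))

  GammaCSIs : ℕ → Set
  GammaCSIs m =
    (∃ λ S → CosecureDominating S × size S ≡ m) ×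
    (∀ S → CosecureDominating S → m ≤ size S)

-- Lower bound: if a cosecure dominating set S has at most one vertex x in X, then S contains
-- all of Y except possibly the vertex that x is exchanged for (after the exchange no X-vertex
-- is left to dominate Y); so |S| ≥ |Y|, symmetrically |S| ≥ |X|, or S has two vertices on each
-- side, and |S| ≥ min(|X|, |Y|, 4).  Three distinct neighbourhoods force |X|, |Y| ≥ 3.
-- Upper bound: X itself is cosecure dominating when Y has at most one pendent vertex (exchange
-- each x for its pendent neighbour if it has one), and symmetrically for Y.  When |X|, |Y| ≥ 4,
-- write x₀, …, xₙ for the chain order of X; then xₙ sees all of Y, a neighbour y₀ of x₀ sees all
-- of X, some neighbour y₁ ≠ y₀ of x₁ sees X - x₀, and xₙ₋₁ misses at most one (pendent) vertex
-- of Y.  The set {xₙ, xₙ₋₁, y₀, y₁} is then cosecure dominating.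

module Submission where

open import Defs
open import Data.Nat using (ℕ; zero; suc; _≤_; _<_; z≤n; s≤s; s≤s⁻¹; _+_; _∸_)
open import Data.Nat.Properties hiding (_≟_)
open import Data.Bool using (Bool; true; false; T)
open import Data.Bool.Properties using (T?; T-≡)
import Data.Bool.Properties as BoolP
open import Data.Fin using (Fin; zero; suc; _≟_; toℕ; fromℕ; inject₁)
open import Data.Fin.Properties using (any?; injective⇒≤; toℕ-injective; toℕ-fromℕ; toℕ-inject₁; toℕ<n)
open import Data.Fin.Subset using (Subset; ∣_∣; _∈_; _∉_; _∪_; ⁅_⁆; ⊤; ⊥; ∁; _⊆_)
open import Data.Fin.Subset.Properties
open import Data.Vec using (tabulate; lookup; []; _∷_)
open import Data.Vec.Properties using ([]=⇒lookup; lookup⇒[]=; lookup∘tabulate; tabulate∘lookup)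
import Data.Vec.Properties as VecP
open import Data.List using (List; []; _∷_; length; map; deduplicate; allFin)
open import Data.List.Relation.Unary.Any using (here; there; index)
open import Data.List.Relation.Unary.Any.Properties using (lookup-index)
open import Data.List.Relation.Unary.All using (_∷_)
open import Data.List.Relation.Unary.AllPairs using (_∷_)
open import Data.List.Membership.Propositional using () renaming (_∈_ to _∈ₗ_; _∉_ to _∉ₗ_)
open import Data.List.Membership.Propositional.Properties using (∈-map⁻; ∈-deduplicate⁻)
import Data.List.Membership.DecPropositional as DecMembership
open import Data.List.Relation.Unary.Unique.Propositional using (Unique)
open import Data.List.Relation.Unary.Unique.DecPropositional.Properties using (deduplicate-!)
open import Data.Sum using (_⊎_; inj₁; inj₂; [_,_])
import Data.Sum as Sum
open import Data.Sum.Properties using (swap-involutive; inj₁-injective; inj₂-injective)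
open import Data.Product using (∃; ∃₂; _×_; _,_; proj₁; proj₂)
open import Data.Empty using (⊥-elim)
open import Function using (_∘_; flip; Equivalence; Inverse)
open import Relation.Nullary using (¬_; yes; no; ¬?; Dec; contradiction)
open import Relation.Nullary.Decidable using (_×-dec_; decidable-stable)
open import Relation.Unary using (Pred; Decidable)
open import Relation.Binary.PropositionalEquality hiding ([_])
open import Relation.Binary.Construct.Closure.ReflexiveTransitive using (_◅_)

-- Counting in subsets of Fin n

private
  variable
    n : ℕ

T-lookup⇒∈ : ∀ (p : Subset n) x → T (lookup p x) → x ∈ p
T-lookup⇒∈ p x t = lookup⇒[]= x p (Equivalence.to T-≡ t)

∈⇒T-lookup : ∀ {p : Subset n} {x} → x ∈ p → T (lookup p x)
∈⇒T-lookup x∈p = Equivalence.from T-≡ ([]=⇒lookup x∈p)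

∈-tabulate⁺ : ∀ (f : Fin n → Bool) {x} → T (f x) → x ∈ tabulate f
∈-tabulate⁺ f {x} t = T-lookup⇒∈ (tabulate f) x (subst T (sym (lookup∘tabulate f x)) t)

∈-tabulate⁻ : ∀ (f : Fin n → Bool) {x} → x ∈ tabulate f → T (f x)
∈-tabulate⁻ f {x} x∈ = subst T (lookup∘tabulate f x) (∈⇒T-lookup x∈)

x∈p⇒1≤∣p∣ : ∀ {p : Subset n} {x} → x ∈ p → 1 ≤ ∣ p ∣
x∈p⇒1≤∣p∣ x∈p = ≤-trans (s≤s z≤n) (x∈p⇒∣p-x∣<∣p∣ x∈p)

x∈p∧y∈p⇒2≤∣p∣ : ∀ {p : Subset n} {x y} → x ∈ p → y ∈ p → x ≢ y → 2 ≤ ∣ p ∣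
x∈p∧y∈p⇒2≤∣p∣ x∈p y∈p x≢y =
  ≤-trans (s≤s (x∈p⇒1≤∣p∣ (x∈p∧x≢y⇒x∈p-y y∈p (x≢y ∘ sym)))) (x∈p⇒∣p-x∣<∣p∣ x∈p)

distinct⇒3≤n : ∀ {x y z : Fin n} → x ≢ y → x ≢ z → y ≢ z → 3 ≤ n
distinct⇒3≤n {n} {x} x≢y x≢z y≢z = subst (3 ≤_) (∣⊤∣≡n n)
  (≤-trans (s≤s (x∈p∧y∈p⇒2≤∣p∣ (x∈p∧x≢y⇒x∈p-y ∈⊤ (x≢y ∘ sym))
                                (x∈p∧x≢y⇒x∈p-y ∈⊤ (x≢z ∘ sym)) y≢z))
           (x∈p⇒∣p-x∣<∣p∣ {x = x} ∈⊤))

∣p∪q∣≤∣p∣+∣q∣ : ∀ (p q : Subset n) → ∣ p ∪ q ∣ ≤ ∣ p ∣ + ∣ q ∣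
∣p∪q∣≤∣p∣+∣q∣ []          []          = z≤n
∣p∪q∣≤∣p∣+∣q∣ (true ∷ p)  (y ∷ q)     =
  s≤s (≤-trans (∣p∪q∣≤∣p∣+∣q∣ p q) (+-monoʳ-≤ ∣ p ∣ (∣p∣≤∣x∷p∣ y q)))
∣p∪q∣≤∣p∣+∣q∣ (false ∷ p) (true ∷ q)  =
  ≤-trans (s≤s (∣p∪q∣≤∣p∣+∣q∣ p q)) (≤-reflexive (sym (+-suc ∣ p ∣ ∣ q ∣)))
∣p∪q∣≤∣p∣+∣q∣ (false ∷ p) (false ∷ q) = ∣p∪q∣≤∣p∣+∣q∣ p q

∈⁅x⁆∪⁅y⁆⁻ : ∀ {x y z : Fin n} → z ∈ ⁅ x ⁆ ∪ ⁅ y ⁆ → z ≡ x ⊎ z ≡ y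
∈⁅x⁆∪⁅y⁆⁻ {x = x} {y} z∈ with x∈p∪q⁻ ⁅ x ⁆ ⁅ y ⁆ z∈
... | inj₁ z∈⁅x⁆ = inj₁ (x∈⁅y⁆⇒x≡y x z∈⁅x⁆)
... | inj₂ z∈⁅y⁆ = inj₂ (x∈⁅y⁆⇒x≡y y z∈⁅y⁆)

∈⁅x⁆∪⁅y⁆⁺ : ∀ {x y z : Fin n} → z ≡ x ⊎ z ≡ y → z ∈ ⁅ x ⁆ ∪ ⁅ y ⁆
∈⁅x⁆∪⁅y⁆⁺ (inj₁ refl) = x∈p∪q⁺ (inj₁ (x∈⁅x⁆ _))
∈⁅x⁆∪⁅y⁆⁺ (inj₂ refl) = x∈p∪q⁺ (inj₂ (x∈⁅x⁆ _))

∣⁅x⁆∪⁅y⁆∣≡2 : ∀ {x y : Fin n} → x ≢ y → ∣ ⁅ x ⁆ ∪ ⁅ y ⁆ ∣ ≡ 2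
∣⁅x⁆∪⁅y⁆∣≡2 {x = x} {y} x≢y = ≤-antisym
  (≤-trans (∣p∪q∣≤∣p∣+∣q∣ ⁅ x ⁆ ⁅ y ⁆) (≤-reflexive (cong₂ _+_ (∣⁅x⁆∣≡1 x) (∣⁅x⁆∣≡1 y))))
  (x∈p∧y∈p⇒2≤∣p∣ (∈⁅x⁆∪⁅y⁆⁺ (inj₁ refl)) (∈⁅x⁆∪⁅y⁆⁺ (inj₂ refl)) x≢y)

∉⁅x⁆∪⁅y⁆ : ∀ {x y z : Fin n} → z ≢ x → z ≢ y → z ∉ ⁅ x ⁆ ∪ ⁅ y ⁆
∉⁅x⁆∪⁅y⁆ z≢x z≢y z∈ = [ z≢x , z≢y ] (∈⁅x⁆∪⁅y⁆⁻ z∈)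

unique∈⇒∣p∣≡1 : ∀ {p : Subset n} {x} → x ∈ p → (∀ {y} → y ∈ p → y ≡ x) → ∣ p ∣ ≡ 1
unique∈⇒∣p∣≡1 {x = x} x∈p unique = ≤-antisym
  (≤-trans (p⊆q⇒∣p∣≤∣q∣ (λ y∈p → subst (_∈ ⁅ x ⁆) (sym (unique y∈p)) (x∈⁅x⁆ x)))
           (≤-reflexive (∣⁅x⁆∣≡1 x)))
  (x∈p⇒1≤∣p∣ x∈p)

all∈⇒n≤∣p∣ : ∀ {p : Subset n} → (∀ x → x ∈ p) → n ≤ ∣ p ∣
all∈⇒n≤∣p∣ {n} {p} all∈ = subst (_≤ ∣ p ∣) (∣⊤∣≡n n) (p⊆q⇒∣p∣≤∣q∣ {p = ⊤} (λ {x} _ → all∈ x))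

allBut∈⇒n≤1+∣p∣ : ∀ {p : Subset n} x → (∀ y → y ≢ x → y ∈ p) → n ≤ 1 + ∣ p ∣
allBut∈⇒n≤1+∣p∣ {n} {p} x others = begin
  n                   ≤⟨ m≤n+m∸n n 1 ⟩
  1 + (n ∸ 1)         ≡⟨ cong (λ k → 1 + (n ∸ k)) (sym (∣⁅x⁆∣≡1 x)) ⟩
  1 + (n ∸ ∣ ⁅ x ⁆ ∣) ≡⟨ cong (1 +_) (sym (∣∁p∣≡n∸∣p∣ ⁅ x ⁆)) ⟩
  1 + ∣ ∁ ⁅ x ⁆ ∣     ≤⟨ +-monoʳ-≤ 1 (p⊆q⇒∣p∣≤∣q∣ ∁⁅x⁆⊆p) ⟩
  1 + ∣ p ∣           ∎
  where
  open ≤-Reasoning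
  ∁⁅x⁆⊆p : ∁ ⁅ x ⁆ ⊆ p
  ∁⁅x⁆⊆p {y} y∈∁ = others y (x∉⁅y⁆⇒x≢y (x∈∁p⇒x∉p y∈∁))

anotherOrOnly : ∀ {ℓ} {P : Pred (Fin n) ℓ} → Decidable P → ∀ x →
                (∃ λ y → y ≢ x × P y) ⊎ (∀ y → P y → y ≡ x)
anotherOrOnly P? x with any? (λ y → ¬? (y ≟ x) ×-dec P? y)
... | yes another = inj₁ another
... | no none = inj₂ λ y Py → decidable-stable (y ≟ x) λ y≢x → none (y , y≢x , Py)

module _ {n : ℕ} where
  open DecMembership (_≟_ {n}) using () renaming (_∈?_ to _∈ₗ?_)

  ∃∉ : (xs : List (Fin n)) → length xs < n → ∃ λ z → z ∉ₗ xs
  ∃∉ xs len<n with any? (λ z → ¬? (z ∈ₗ? xs))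
  ... | yes fresh = fresh
  ... | no none = contradiction (injective⇒≤ index-injective) (<⇒≱ len<n)
    where
    covered : ∀ z → z ∈ₗ xs
    covered z = decidable-stable (z ∈ₗ? xs) λ z∉ → none (z , z∉)
    index-injective : ∀ {z z'} → index (covered z) ≡ index (covered z') → z ≡ z'
    index-injective {z} {z'} eq = trans (lookup-index (covered z))
      (trans (cong (Data.List.lookup xs) eq) (sym (lookup-index (covered z'))))

-- Bipartite graphs and vertex exchanges

uniqueNeighbour⇒pendentX : ∀ {p q} (E : Fin p → Fin q → Bool) {x y} → T (E x y) →
                           (∀ y' → T (E x y') → y' ≡ y) → degX E x ≡ 1
uniqueNeighbour⇒pendentX E x~y unique =
  unique∈⇒∣p∣≡1 (∈-tabulate⁺ (E _) x~y) (λ y'∈ → unique _ (∈-tabulate⁻ (E _) y'∈))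

module _ {p q : ℕ} (E : Fin p → Fin q → Bool) where

  NoIsolatedX : Set
  NoIsolatedX = ∀ x → ∃ λ y → T (E x y)

  NoIsolatedY : Set
  NoIsolatedY = ∀ y → ∃ λ x → T (E x y)

  connected⇒noIsolatedX : Connected E → Fin q → NoIsolatedX
  connected⇒noIsolatedX c y₀ x with c (inj₁ x) (inj₂ y₀)
  ... | _◅_ {j = inj₂ y} x~y _ = y , x~y
  ... | _◅_ {j = inj₁ _} () _

  connected⇒noIsolatedY : Connected E → Fin p → NoIsolatedY
  connected⇒noIsolatedY c x₀ y with c (inj₂ y) (inj₁ x₀)
  ... | _◅_ {j = inj₁ x} x~y _ = x , x~y
  ... | _◅_ {j = inj₂ _} () _

  anotherNeighbour : NoIsolatedY → ∀ x y → ¬ (T (E x y) × degY E y ≡ 1) →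
                     ∃ λ x' → x' ≢ x × T (E x' y)
  anotherNeighbour ny x y notPendentAtX with anotherOrOnly (λ x' → T? (E x' y)) x
  ... | inj₁ another = another
  ... | inj₂ onlyX with ny y
  ...   | x' , x'~y with onlyX x' x'~y
  ...     | refl = ⊥-elim (notPendentAtX (x'~y , uniqueNeighbour⇒pendentX (flip E) x'~y onlyX))

  swap-v : ∀ S u v → swap E S u v v ≡ true
  swap-v S u v with _≟V_ E v v
  ... | yes _ = refl
  ... | no v≢v = ⊥-elim (v≢v refl)

  swap-u : ∀ S u v → u ≢ v → swap E S u v u ≡ false
  swap-u S u v u≢v with _≟V_ E u v
  ... | yes u≡v = ⊥-elim (u≢v u≡v)
  ... | no _ with _≟V_ E u u
  ...   | yes _ = refl
  ...   | no u≢u = ⊥-elim (u≢u refl)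

  swap-o : ∀ S u v {w} → w ≢ v → w ≢ u → swap E S u v w ≡ S w
  swap-o S u v {w} w≢v w≢u with _≟V_ E w v
  ... | yes w≡v = ⊥-elim (w≢v w≡v)
  ... | no _ with _≟V_ E w u
  ...   | yes w≡u = ⊥-elim (w≢u w≡u)
  ...   | no _ = refl

  swap-∈-new : ∀ S u v → T (swap E S u v v)
  swap-∈-new S u v = subst T (sym (swap-v S u v)) _

  swap-∈-old : ∀ S u v w → w ≢ u → T (S w) → T (swap E S u v w)
  swap-∈-old S u v w w≢u s with _≟V_ E w v
  ... | yes _ = _
  ... | no _ with _≟V_ E w u
  ...   | yes w≡u = ⊥-elim (w≢u w≡u)
  ...   | no _ = s

  swap-∉⇒≢new : ∀ S u v {w} → ¬ T (swap E S u v w) → w ≢ v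
  swap-∉⇒≢new S u v w∉ refl = w∉ (swap-∈-new S u v)

  swap-∉⇒≡old : ∀ S u v {w} → ¬ T (swap E S u v w) → T (S w) → w ≡ u
  swap-∉⇒≡old S u v {w} w∉S' w∈S =
    decidable-stable (_≟V_ E w u) λ w≢u → w∉S' (swap-∈-old S u v w w≢u w∈S)

  swap-∈⁻ : ∀ S u v {w} → T (swap E S u v w) → w ≡ v ⊎ (w ≢ u × T (S w))
  swap-∈⁻ S u v {w} s with _≟V_ E w v
  ... | yes w≡v = inj₁ w≡v
  ... | no _ with _≟V_ E w u
  ...   | no w≢u = inj₂ (w≢u , s)

  dominatedBy : ∀ {S} y x → T (S (inj₂ y)) → T (S (inj₁ x)) →
                (∀ x' → ¬ T (S (inj₁ x')) → T (E x' y)) →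
                (∀ y' → ¬ T (S (inj₂ y')) → T (E x y')) → Dominating E S
  dominatedBy y x y∈S x∈S coversX coversY (inj₁ x') x'∉S = inj₂ y , y∈S , coversX x' x'∉S
  dominatedBy y x y∈S x∈S coversX coversY (inj₂ y') y'∉S = inj₁ x , x∈S , coversY y' y'∉S

module _ {p q : ℕ} (E : Fin p → Fin q → Bool) where

  private
    ⊎-swap-≢ : ∀ {u v : Vtx p q} → u ≢ v → Sum.swap u ≢ Sum.swap v
    ⊎-swap-≢ {u} {v} u≢v eq =
      u≢v (trans (sym (swap-involutive u)) (trans (cong Sum.swap eq) (swap-involutive v)))

  swap-flip : ∀ {S S'} → (∀ w → S' (Sum.swap w) ≡ S w) →
              ∀ u v w → swap (flip E) S' (Sum.swap u) (Sum.swap v) (Sum.swap w) ≡ swap E S u v w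
  swap-flip {S} {S'} S'∘swap≡S u v w = byCases (_≟V_ E w v) (_≟V_ E w u)
    where
    u' v' : Vtx q p
    u' = Sum.swap u
    v' = Sum.swap v
    byCases : Dec (w ≡ v) → Dec (w ≡ u) → swap (flip E) S' u' v' (Sum.swap w) ≡ swap E S u v w
    byCases (yes refl) _ = trans (swap-v (flip E) S' u' v') (sym (swap-v E S u v))
    byCases (no w≢v) (yes refl) =
      trans (swap-u (flip E) S' u' v' (⊎-swap-≢ w≢v)) (sym (swap-u E S u v w≢v))
    byCases (no w≢v) (no w≢u) =
      trans (swap-o (flip E) S' u' v' (⊎-swap-≢ w≢v) (⊎-swap-≢ w≢u))
            (trans (S'∘swap≡S w) (sym (swap-o E S u v w≢v w≢u)))

  dominating-flip : ∀ {S S'} → (∀ w → S' (Sum.swap w) ≡ S w) → Dominating E S → Dominating (flip E) S'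
  dominating-flip S'∘swap≡S dom (inj₁ y) y∉S'
    with dom (inj₂ y) (subst (¬_ ∘ T) (S'∘swap≡S (inj₂ y)) y∉S')
  ... | inj₁ x , x∈S , x~y = inj₂ x , subst T (sym (S'∘swap≡S (inj₁ x))) x∈S , x~y
  dominating-flip S'∘swap≡S dom (inj₂ x) x∉S'
    with dom (inj₁ x) (subst (¬_ ∘ T) (S'∘swap≡S (inj₁ x)) x∉S')
  ... | inj₂ y , y∈S , x~y = inj₁ y , subst T (sym (S'∘swap≡S (inj₂ y))) y∈S , x~y

  cosecure-flip : ∀ {S} → CosecureDominating E S → CosecureDominating (flip E) (S ∘ Sum.swap)
  cosecure-flip {S} (dom , cs) = dominating-flip S∘swap²≡S dom , cs'
    where
    S∘swap²≡S : ∀ w → S (Sum.swap (Sum.swap w)) ≡ S w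
    S∘swap²≡S w = cong S (swap-involutive w)
    cs' : ∀ u → T (S (Sum.swap u)) → ∃ λ v → Adj (flip E) u v × ¬ T (S (Sum.swap v)) ×
                                      Dominating (flip E) (swap (flip E) (S ∘ Sum.swap) u v)
    cs' (inj₁ y) y∈S with cs (inj₂ y) y∈S
    ... | inj₁ x , y~x , x∉S , dom' =
      inj₂ x , y~x , x∉S , dominating-flip (swap-flip S∘swap²≡S (inj₂ y) (inj₁ x)) dom'
    cs' (inj₂ x) x∈S with cs (inj₁ x) x∈S
    ... | inj₂ y , x~y , y∉S , dom' =
      inj₁ y , x~y , y∉S , dominating-flip (swap-flip S∘swap²≡S (inj₁ x) (inj₂ y)) dom'

  size-flip : ∀ S → size (flip E) (S ∘ Sum.swap) ≡ size E S
  size-flip S = +-comm (∣ tabulate (S ∘ inj₂) ∣) (∣ tabulate (S ∘ inj₁) ∣)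

module _ {p q : ℕ} (E : Fin p → Fin q → Bool) where

  disjointFromX⇒⊇Y : ∀ {S} → Dominating E S → (∀ x → ¬ T (S (inj₁ x))) → ∀ y → T (S (inj₂ y))
  disjointFromX⇒⊇Y {S} dom noX y with T? (S (inj₂ y))
  ... | yes y∈S = y∈S
  ... | no y∉S with dom (inj₂ y) y∉S
  ...   | inj₁ x , x∈S , _ = ⊥-elim (noX x x∈S)

  -- If x₀ is the only X-vertex of S, swapping it out for y₀ leaves no X-vertex at all,
  -- so the swapped set contains Y, i.e. S contains Y - y₀.
  cosecure⇒2≤∣S∩X∣⊎q≤size : ∀ {S} → CosecureDominating E S →
                            2 ≤ ∣ tabulate (S ∘ inj₁) ∣ ⊎ q ≤ size E S
  cosecure⇒2≤∣S∩X∣⊎q≤size {S} (dom , cs) with any? (λ x → T? (S (inj₁ x)))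
  ... | no noX = inj₂ (≤-trans (all∈⇒n≤∣p∣ Y⊆S) (m≤n+m _ _))
    where
    Y⊆S : ∀ y → y ∈ tabulate (S ∘ inj₂)
    Y⊆S y = ∈-tabulate⁺ (S ∘ inj₂) (disjointFromX⇒⊇Y dom (λ x x∈S → noX (x , x∈S)) y)
  ... | yes (x₀ , x₀∈S) with anotherOrOnly (λ x → T? (S (inj₁ x))) x₀
  ...   | inj₁ (x , x≢x₀ , x∈S) =
    inj₁ (x∈p∧y∈p⇒2≤∣p∣ (∈-tabulate⁺ (S ∘ inj₁) x∈S) (∈-tabulate⁺ (S ∘ inj₁) x₀∈S) x≢x₀)
  ...   | inj₂ onlyX₀ with cs (inj₁ x₀) x₀∈S
  ...     | inj₂ y₀ , _ , _ , dom' = inj₂ (begin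
    q                                                 ≤⟨ allBut∈⇒n≤1+∣p∣ y₀ others∈S ⟩
    1 + ∣ tabulate (S ∘ inj₂) ∣                       ≤⟨ +-monoˡ-≤ _ (x∈p⇒1≤∣p∣ x₀∈S∩X) ⟩
    ∣ tabulate (S ∘ inj₁) ∣ + ∣ tabulate (S ∘ inj₂) ∣ ∎)
    where
    open ≤-Reasoning
    x₀∈S∩X : x₀ ∈ tabulate (S ∘ inj₁)
    x₀∈S∩X = ∈-tabulate⁺ (S ∘ inj₁) x₀∈S
    S' : VSet E
    S' = swap E S (inj₁ x₀) (inj₂ y₀)
    S'∩X≡∅ : ∀ x → ¬ T (S' (inj₁ x))
    S'∩X≡∅ x x∈S' with swap-∈⁻ E S (inj₁ x₀) (inj₂ y₀) x∈S'
    ... | inj₂ (x≢x₀ , x∈S) = x≢x₀ (cong inj₁ (onlyX₀ x x∈S))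
    others∈S : ∀ y → y ≢ y₀ → y ∈ tabulate (S ∘ inj₂)
    others∈S y y≢y₀ with swap-∈⁻ E S (inj₁ x₀) (inj₂ y₀) (disjointFromX⇒⊇Y dom' S'∩X≡∅ y)
    ... | inj₁ y≡y₀ = ⊥-elim (y≢y₀ (inj₂-injective y≡y₀))
    ... | inj₂ (_ , y∈S) = ∈-tabulate⁺ (S ∘ inj₂) y∈S

  fromSides : Subset p → Subset q → VSet E
  fromSides P Q (inj₁ x) = lookup P x
  fromSides P Q (inj₂ y) = lookup Q y

  size-fromSides : ∀ P Q → size E (fromSides P Q) ≡ ∣ P ∣ + ∣ Q ∣
  size-fromSides P Q = cong₂ (λ P' Q' → ∣ P' ∣ + ∣ Q' ∣) (tabulate∘lookup P) (tabulate∘lookup Q)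

  -- Exchanging x for its pendent neighbour, if it has one, keeps every other
  -- Y-vertex adjacent to some vertex of X - x.
  swapPartner : NoIsolatedX E → AtMostOnePendentY E → ∀ x →
                ∃ λ y → T (E x y) × ∀ y' → y' ≢ y → ¬ (T (E x y') × degY E y' ≡ 1)
  swapPartner nx pY x with any? (λ y → T? (E x y) ×-dec (degY E y Data.Nat.≟ 1))
  ... | yes (y , x~y , y-pendent) =
    y , x~y , λ y' y'≢y (_ , y'-pendent) → y'≢y (pY y' y y'-pendent y-pendent)
  ... | no none with nx x
  ...   | y , x~y = y , x~y , λ y' _ pendent → none (y' , pendent)

  X-cosecure : NoIsolatedX E → NoIsolatedY E → AtMostOnePendentY E →
               CosecureDominating E (fromSides ⊤ ⊥)
  X-cosecure nx ny pY = dom , cs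
    where
    X : VSet E
    X = fromSides ⊤ ⊥
    x∈X : ∀ x → T (X (inj₁ x))
    x∈X x = ∈⇒T-lookup (∈⊤ {x = x})
    y∉X : ∀ y → ¬ T (X (inj₂ y))
    y∉X y = ∉⊥ ∘ T-lookup⇒∈ ⊥ y
    dom : Dominating E X
    dom (inj₁ x) x∉X = ⊥-elim (x∉X (x∈X x))
    dom (inj₂ y) _ with ny y
    ... | x , x~y = inj₁ x , x∈X x , x~y
    cs : ∀ u → T (X u) → ∃ λ v → Adj E u v × ¬ T (X v) × Dominating E (swap E X u v)
    cs (inj₂ y) y∈X = ⊥-elim (y∉X y y∈X)
    cs (inj₁ x) _ with swapPartner nx pY x
    ... | y , x~y , noRival = inj₂ y , x~y , y∉X y , dom'
      where
      dom' : Dominating E (swap E X (inj₁ x) (inj₂ y))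
      dom' (inj₁ x') x'∉X' with swap-∉⇒≡old E X (inj₁ x) (inj₂ y) {inj₁ x'} x'∉X' (x∈X x')
      ... | refl = inj₂ y , swap-∈-new E X (inj₁ x) (inj₂ y) , x~y
      dom' (inj₂ y') y'∉X'
        with anotherNeighbour E ny x y' (noRival y' (swap-∉⇒≢new E X (inj₁ x) (inj₂ y) y'∉X' ∘ cong inj₂))
      ... | x' , x'≢x , x'~y' =
        inj₁ x' , swap-∈-old E X (inj₁ x) (inj₂ y) (inj₁ x') (x'≢x ∘ inj₁-injective) (x∈X x') , x'~y'

  cosecureOfSizeP : NoIsolatedX E → NoIsolatedY E → AtMostOnePendentY E →
                    ∃ λ S → CosecureDominating E S × size E S ≡ p
  cosecureOfSizeP nx ny pY = fromSides ⊤ ⊥ , X-cosecure nx ny pY ,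
    trans (size-fromSides ⊤ ⊥) (trans (cong₂ _+_ (∣⊤∣≡n p) (∣⊥∣≡0 q)) (+-identityʳ p))

-- The Y-side statements are the X-side ones for the transposed graph flip E.
module _ {p q : ℕ} (E : Fin p → Fin q → Bool) where

  cosecure⇒2≤∣S∩Y∣⊎p≤size : ∀ {S} → CosecureDominating E S →
                            2 ≤ ∣ tabulate (S ∘ inj₂) ∣ ⊎ p ≤ size E S
  cosecure⇒2≤∣S∩Y∣⊎p≤size {S} cs with cosecure⇒2≤∣S∩X∣⊎q≤size (flip E) (cosecure-flip E cs)
  ... | inj₁ 2≤∣Y∣ = inj₁ 2≤∣Y∣
  ... | inj₂ p≤size = inj₂ (subst (p ≤_) (size-flip E S) p≤size)

  cosecure⇒size≥ : ∀ {m S} → m ≤ p → m ≤ q → m ≤ 4 → CosecureDominating E S → m ≤ size E S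
  cosecure⇒size≥ m≤p m≤q m≤4 cs with cosecure⇒2≤∣S∩X∣⊎q≤size E cs | cosecure⇒2≤∣S∩Y∣⊎p≤size cs
  ... | inj₂ q≤size | _ = ≤-trans m≤q q≤size
  ... | inj₁ _ | inj₂ p≤size = ≤-trans m≤p p≤size
  ... | inj₁ 2≤∣X∣ | inj₁ 2≤∣Y∣ = ≤-trans m≤4 (+-mono-≤ 2≤∣X∣ 2≤∣Y∣)

  cosecureOfSizeQ : NoIsolatedX E → NoIsolatedY E → AtMostOnePendentX E →
                    ∃ λ S → CosecureDominating E S × size E S ≡ q
  cosecureOfSizeQ nx ny pX with cosecureOfSizeP (flip E) ny nx pX
  ... | S , cs , size≡q =
    S ∘ Sum.swap , cosecure-flip (flip E) cs , trans (size-flip (flip E) S) size≡q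

-- Classes of neighbourhoods and chain graphs

threeDistinct : ∀ {a} {A : Set a} {xs : List A} → Unique xs → 3 ≤ length xs →
                ∃₂ λ u v → ∃ λ w → u ∈ₗ xs × v ∈ₗ xs × w ∈ₗ xs × u ≢ v × u ≢ w × v ≢ w
threeDistinct {xs = []}          _ ()
threeDistinct {xs = _ ∷ []}      _ (s≤s ())
threeDistinct {xs = _ ∷ _ ∷ []}  _ (s≤s (s≤s ()))
threeDistinct {xs = u ∷ v ∷ w ∷ _} ((u≢v ∷ u≢w ∷ _) ∷ (v≢w ∷ _) ∷ _) _ =
  u , v , w , here refl , there (here refl) , there (there (here refl)) , u≢v , u≢w , v≢w

boolPigeonhole : (a b c : Bool) → a ≡ b ⊎ a ≡ c ⊎ b ≡ c
boolPigeonhole true  true  _     = inj₁ refl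
boolPigeonhole false false _     = inj₁ refl
boolPigeonhole true  false true  = inj₂ (inj₁ refl)
boolPigeonhole false true  false = inj₂ (inj₁ refl)
boolPigeonhole true  false false = inj₂ (inj₂ refl)
boolPigeonhole false true  true  = inj₂ (inj₂ refl)

module _ {p q : ℕ} (E : Fin p → Fin q → Bool) where

  ThreeNeighbourhoods : Set
  ThreeNeighbourhoods = ∃₂ λ x x' → ∃ λ x'' →
    NX E x ≢ NX E x' × NX E x ≢ NX E x'' × NX E x' ≢ NX E x''

  neighbourhoodClasses : List (Subset q)
  neighbourhoodClasses = deduplicate (VecP.≡-dec BoolP._≟_) (map (NX E) (allFin p))

  ∈-neighbourhoodClasses⁻ : ∀ {N} → N ∈ₗ neighbourhoodClasses → ∃ λ x → N ≡ NX E x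
  ∈-neighbourhoodClasses⁻ N∈ with ∈-map⁻ (NX E) (∈-deduplicate⁻ (VecP.≡-dec BoolP._≟_) _ N∈)
  ... | x , _ , N≡NX = x , N≡NX

  3≤numClasses⇒threeNeighbourhoods : 3 ≤ numClasses E → ThreeNeighbourhoods
  3≤numClasses⇒threeNeighbourhoods 3≤k
    with threeDistinct (deduplicate-! (VecP.≡-dec BoolP._≟_) (map (NX E) (allFin p))) 3≤k
  ... | N , N' , N'' , N∈ , N'∈ , N''∈ , N≢N' , N≢N'' , N'≢N''
    with ∈-neighbourhoodClasses⁻ N∈ | ∈-neighbourhoodClasses⁻ N'∈ | ∈-neighbourhoodClasses⁻ N''∈
  ... | x , refl | x' , refl | x'' , refl = x , x' , x'' , N≢N' , N≢N'' , N'≢N''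

  threeNeighbourhoods⇒3≤p : ThreeNeighbourhoods → 3 ≤ p
  threeNeighbourhoods⇒3≤p (_ , _ , _ , ≢₁ , ≢₂ , ≢₃) =
    distinct⇒3≤n (≢₁ ∘ cong (NX E)) (≢₂ ∘ cong (NX E)) (≢₃ ∘ cong (NX E))

  3≤numClasses⇒3≤p : 3 ≤ numClasses E → 3 ≤ p
  3≤numClasses⇒3≤p = threeNeighbourhoods⇒3≤p ∘ 3≤numClasses⇒threeNeighbourhoods

  neighbourhood-determinedBy : ∀ {y₀ y₁} → (∀ y → y ≡ y₀ ⊎ y ≡ y₁) → (∀ x → T (E x y₀)) →
                               ∀ {x x'} → E x y₁ ≡ E x' y₁ → NX E x ≡ NX E x'
  neighbourhood-determinedBy covers y₀-universal {x} {x'} eq = VecP.tabulate-cong agree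
    where
    T⇒≡true : ∀ {b} → T b → b ≡ true
    T⇒≡true = Equivalence.to T-≡
    agree : ∀ y → E x y ≡ E x' y
    agree y with covers y
    ... | inj₁ refl = trans (T⇒≡true (y₀-universal x)) (sym (T⇒≡true (y₀-universal x')))
    ... | inj₂ refl = eq

  twoYs⇒¬threeNeighbourhoods : ∀ {y₀ y₁} → (∀ y → y ≡ y₀ ⊎ y ≡ y₁) → (∀ x → T (E x y₀)) →
                               ¬ ThreeNeighbourhoods
  twoYs⇒¬threeNeighbourhoods {y₁ = y₁} covers y₀-universal (x , x' , x'' , ≢₁ , ≢₂ , ≢₃)
    with boolPigeonhole (E x y₁) (E x' y₁) (E x'' y₁)
  ... | inj₁ eq        = ≢₁ (neighbourhood-determinedBy covers y₀-universal eq)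
  ... | inj₂ (inj₁ eq) = ≢₂ (neighbourhood-determinedBy covers y₀-universal eq)
  ... | inj₂ (inj₂ eq) = ≢₃ (neighbourhood-determinedBy covers y₀-universal eq)

  threeNeighbourhoods⇒3≤q : ∀ {y₀ y₁} → (∀ x → T (E x y₀)) → y₁ ≢ y₀ → ThreeNeighbourhoods → 3 ≤ q
  threeNeighbourhoods⇒3≤q {y₀} {y₁} y₀-universal y₁≢y₀ three
    with any? (λ y → ¬? (y ≟ y₀) ×-dec ¬? (y ≟ y₁))
  ... | yes (y , y≢y₀ , y≢y₁) = distinct⇒3≤n (y₁≢y₀ ∘ sym) (y≢y₀ ∘ sym) (y≢y₁ ∘ sym)
  ... | no none = ⊥-elim (twoYs⇒¬threeNeighbourhoods covers y₀-universal three)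
    where
    covers : ∀ y → y ≡ y₀ ⊎ y ≡ y₁
    covers y with y ≟ y₀ | y ≟ y₁
    ... | yes y≡y₀ | _        = inj₁ y≡y₀
    ... | no _     | yes y≡y₁ = inj₂ y≡y₁
    ... | no y≢y₀  | no y≢y₁  = ⊥-elim (none (y , y≢y₀ , y≢y₁))

module ChainGraph {r q : ℕ} (E : Fin (2 + r) → Fin q → Bool) (chain : IsChainGraph E)
                  (connected : Connected E) (pX : AtMostOnePendentX E) where

  open Inverse (proj₁ chain) using (to; from; strictlyInverseˡ; strictlyInverseʳ)

  pos : Fin (2 + r) → ℕ
  pos x = toℕ (from x)

  pos-to : ∀ i → pos (to i) ≡ toℕ i
  pos-to i = cong toℕ (strictlyInverseʳ i)

  pos-≢ : ∀ {x x'} → pos x ≢ pos x' → x ≢ x'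
  pos-≢ pos≢ refl = pos≢ refl

  pos-injective : ∀ {x x'} → pos x ≡ pos x' → x ≡ x'
  pos-injective {x} {x'} eq =
    trans (sym (strictlyInverseˡ x)) (trans (cong to (toℕ-injective eq)) (strictlyInverseˡ x'))

  to-≢ : ∀ {i j} → toℕ i ≢ toℕ j → to i ≢ to j
  to-≢ {i} {j} i≢j = pos-≢ λ eq → i≢j (trans (sym (pos-to i)) (trans eq (pos-to j)))

  adj-mono : ∀ {x x' y} → pos x ≤ pos x' → T (E x y) → T (E x' y)
  adj-mono {x} {x'} {y} x≤x' x~y = subst (λ z → T (E z y)) (strictlyInverseˡ x')
    (proj₂ chain (from x) (from x') x≤x' y (subst (λ z → T (E z y)) (sym (strictlyInverseˡ x)) x~y))

  someY : Fin q
  someY with connected (inj₁ zero) (inj₁ (suc zero))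
  ... | _◅_ {j = inj₂ y} _ _ = y
  ... | _◅_ {j = inj₁ _} () _

  noIsolatedX : NoIsolatedX E
  noIsolatedX = connected⇒noIsolatedX E connected someY

  noIsolatedY : NoIsolatedY E
  noIsolatedY = connected⇒noIsolatedY E connected zero

  -- The first, second and last vertex in the chain order of X = {x₀, …, xₙ}, so n = 1 + r.
  x₀ x₁ xₙ : Fin (2 + r)
  x₀ = to zero
  x₁ = to (suc zero)
  xₙ = to (fromℕ (suc r))

  pos-xₙ : pos xₙ ≡ 1 + r
  pos-xₙ = trans (pos-to (fromℕ (suc r))) (toℕ-fromℕ (suc r))

  xₙ-universal : ∀ y → T (E xₙ y)
  xₙ-universal y with noIsolatedY y
  ... | x , x~y = adj-mono (subst (pos x ≤_) (sym pos-xₙ) (<⇒≤pred (toℕ<n (from x)))) x~y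

  y₀ : Fin q
  y₀ = proj₁ (noIsolatedX x₀)

  y₀-universal : ∀ x → T (E x y₀)
  y₀-universal x = adj-mono (subst (_≤ pos x) (sym (pos-to zero)) z≤n) (proj₂ (noIsolatedX x₀))

  y₁-spec : ∃ λ y₁ → y₁ ≢ y₀ × T (E x₁ y₁)
  y₁-spec with anotherOrOnly (λ y → T? (E x₁ y)) y₀
  ... | inj₁ another = another
  ... | inj₂ onlyY₀ =
    contradiction (pX x₀ x₁ (pendent x₀ (λ y → onlyY₀ y ∘ x₀⊆x₁)) (pendent x₁ onlyY₀)) (to-≢ 0≢1+n)
    where
    x₀⊆x₁ : ∀ {y} → T (E x₀ y) → T (E x₁ y)
    x₀⊆x₁ = adj-mono (subst₂ _≤_ (sym (pos-to zero)) (sym (pos-to (suc zero))) z≤n)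
    pendent : ∀ x → (∀ y → T (E x y) → y ≡ y₀) → degX E x ≡ 1
    pendent x onlyY₀ = uniqueNeighbour⇒pendentX E (y₀-universal x) onlyY₀

  y₁ : Fin q
  y₁ = proj₁ y₁-spec

  y₁≢y₀ : y₁ ≢ y₀
  y₁≢y₀ = proj₁ (proj₂ y₁-spec)

  y₁-adjacent : ∀ x → x ≢ x₀ → T (E x y₁)
  y₁-adjacent x x≢x₀ = adj-mono 1≤pos-x (proj₂ (proj₂ y₁-spec))
    where
    1≤pos-x : pos x₁ ≤ pos x
    1≤pos-x = subst (_≤ pos x) (sym (pos-to (suc zero)))
      (≤∧≢⇒< z≤n λ 0≡pos-x → x≢x₀ (pos-injective (trans (sym 0≡pos-x) (sym (pos-to zero)))))

  module SizeFour (2≤r : 2 ≤ r) (4≤q : 4 ≤ q) (pY : AtMostOnePendentY E) where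

    xₙ₋₁ : Fin (2 + r)
    xₙ₋₁ = to (inject₁ (fromℕ r))

    pos-xₙ₋₁ : pos xₙ₋₁ ≡ r
    pos-xₙ₋₁ = trans (pos-to (inject₁ (fromℕ r))) (trans (toℕ-inject₁ (fromℕ r)) (toℕ-fromℕ r))

    xₙ₋₁-dominates : ∀ {x y} → x ≢ xₙ → T (E x y) → T (E xₙ₋₁ y)
    xₙ₋₁-dominates {x} x≢xₙ = adj-mono (subst (pos x ≤_) (sym pos-xₙ₋₁) (<⇒≤pred pos-x<1+r))
      where
      pos-x<1+r : pos x < 1 + r
      pos-x<1+r =
        ≤∧≢⇒< (<⇒≤pred (toℕ<n (from x))) λ eq → x≢xₙ (pos-injective (trans eq (sym pos-xₙ)))

    missed⇒pendent : ∀ {y} → ¬ T (E xₙ₋₁ y) → degY E y ≡ 1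
    missed⇒pendent {y} missed = uniqueNeighbour⇒pendentX (flip E) (xₙ-universal y)
      λ x x~y → decidable-stable (x ≟ xₙ) λ x≢xₙ → missed (xₙ₋₁-dominates x≢xₙ x~y)

    xₙ₋₁≢xₙ : xₙ₋₁ ≢ xₙ
    xₙ₋₁≢xₙ = pos-≢ λ eq → 1+n≢n (trans (sym pos-xₙ) (trans (sym eq) pos-xₙ₋₁))

    x₀≢xₙ : x₀ ≢ xₙ
    x₀≢xₙ = pos-≢ λ eq → 0≢1+n (trans (sym (pos-to zero)) (trans eq pos-xₙ))

    x₀≢xₙ₋₁ : x₀ ≢ xₙ₋₁
    x₀≢xₙ₋₁ = pos-≢ λ eq →
      <⇒≢ (≤-trans (s≤s z≤n) 2≤r) (trans (sym (pos-to zero)) (trans eq pos-xₙ₋₁))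

    x₁≢xₙ : x₁ ≢ xₙ
    x₁≢xₙ = pos-≢ λ eq →
      <⇒≢ (s≤s (≤-trans (s≤s z≤n) 2≤r)) (trans (sym (pos-to (suc zero))) (trans eq pos-xₙ))

    x₁≢xₙ₋₁ : x₁ ≢ xₙ₋₁
    x₁≢xₙ₋₁ = pos-≢ λ eq → <⇒≢ 2≤r (trans (sym (pos-to (suc zero))) (trans eq pos-xₙ₋₁))

    -- Every Y-vertex missed by xₙ₋₁ is pendent, so there is at most one.
    y⋆-spec : ∃ λ y⋆ → y⋆ ≢ y₀ × y⋆ ≢ y₁ × ∀ y → y ≢ y⋆ → T (E xₙ₋₁ y)
    y⋆-spec with any? (λ y → ¬? (T? (E xₙ₋₁ y)))
    ... | yes (y⋆ , missed) =
      y⋆ , (λ { refl → missed (y₀-universal xₙ₋₁) }) ,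
      (λ { refl → missed (y₁-adjacent xₙ₋₁ (x₀≢xₙ₋₁ ∘ sym)) }) ,
      λ y y≢y⋆ → decidable-stable (T? _) λ missed' →
        y≢y⋆ (pY y y⋆ (missed⇒pendent missed') (missed⇒pendent missed))
    ... | no none with ∃∉ (y₀ ∷ y₁ ∷ []) (≤-trans (s≤s (s≤s (s≤s z≤n))) 4≤q)
    ...   | y⋆ , y⋆∉ = y⋆ , y⋆∉ ∘ here , y⋆∉ ∘ there ∘ here ,
      λ y _ → decidable-stable (T? _) λ missed → none (y , missed)

    y⋆ : Fin q
    y⋆ = proj₁ y⋆-spec

    xₙ₋₁-adjacent : ∀ y → y ≢ y⋆ → T (E xₙ₋₁ y)
    xₙ₋₁-adjacent = proj₂ (proj₂ (proj₂ y⋆-spec))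

    y₂-spec : ∃ λ y₂ → y₂ ≢ y₀ × y₂ ≢ y₁ × T (E xₙ₋₁ y₂)
    y₂-spec with ∃∉ (y₀ ∷ y₁ ∷ y⋆ ∷ []) 4≤q
    ... | y₂ , y₂∉ = y₂ , y₂∉ ∘ here , y₂∉ ∘ there ∘ here , xₙ₋₁-adjacent y₂ (y₂∉ ∘ there ∘ there ∘ here)

    S : VSet E
    S = fromSides E (⁅ xₙ ⁆ ∪ ⁅ xₙ₋₁ ⁆) (⁅ y₀ ⁆ ∪ ⁅ y₁ ⁆)

    size-S : size E S ≡ 4
    size-S = trans (size-fromSides E (⁅ xₙ ⁆ ∪ ⁅ xₙ₋₁ ⁆) (⁅ y₀ ⁆ ∪ ⁅ y₁ ⁆))
                   (cong₂ _+_ (∣⁅x⁆∪⁅y⁆∣≡2 (xₙ₋₁≢xₙ ∘ sym)) (∣⁅x⁆∪⁅y⁆∣≡2 (y₁≢y₀ ∘ sym)))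

    xₙ∈S : T (S (inj₁ xₙ))
    xₙ∈S = ∈⇒T-lookup {p = ⁅ xₙ ⁆ ∪ ⁅ xₙ₋₁ ⁆} (∈⁅x⁆∪⁅y⁆⁺ (inj₁ refl))

    xₙ₋₁∈S : T (S (inj₁ xₙ₋₁))
    xₙ₋₁∈S = ∈⇒T-lookup {p = ⁅ xₙ ⁆ ∪ ⁅ xₙ₋₁ ⁆} (∈⁅x⁆∪⁅y⁆⁺ (inj₂ refl))

    y₀∈S : T (S (inj₂ y₀))
    y₀∈S = ∈⇒T-lookup {p = ⁅ y₀ ⁆ ∪ ⁅ y₁ ⁆} (∈⁅x⁆∪⁅y⁆⁺ (inj₁ refl))

    y₁∈S : T (S (inj₂ y₁))
    y₁∈S = ∈⇒T-lookup {p = ⁅ y₀ ⁆ ∪ ⁅ y₁ ⁆} (∈⁅x⁆∪⁅y⁆⁺ (inj₂ refl))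

    ∉S : ∀ {m} {a b z : Fin m} → z ≢ a → z ≢ b → ¬ T (lookup (⁅ a ⁆ ∪ ⁅ b ⁆) z)
    ∉S {z = z} z≢a z≢b = ∉⁅x⁆∪⁅y⁆ z≢a z≢b ∘ T-lookup⇒∈ _ z

    S∩X : ∀ {x} → T (S (inj₁ x)) → x ≡ xₙ ⊎ x ≡ xₙ₋₁
    S∩X {x} = ∈⁅x⁆∪⁅y⁆⁻ ∘ T-lookup⇒∈ _ x

    S∩Y : ∀ {y} → T (S (inj₂ y)) → y ≡ y₀ ⊎ y ≡ y₁
    S∩Y {y} = ∈⁅x⁆∪⁅y⁆⁻ ∘ T-lookup⇒∈ _ y

    S-cosecure : CosecureDominating E S
    S-cosecure = dominatedBy E y₀ xₙ y₀∈S xₙ∈S (λ x _ → y₀-universal x) (λ y _ → xₙ-universal y) , cs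
      where
      cs : ∀ u → T (S u) → ∃ λ v → Adj E u v × ¬ T (S v) × Dominating E (swap E S u v)
      cs (inj₁ x) x∈S with S∩X x∈S
      ... | inj₁ refl =
        inj₂ y⋆ , xₙ-universal y⋆ , ∉S (proj₁ (proj₂ y⋆-spec)) (proj₁ (proj₂ (proj₂ y⋆-spec))) ,
        dominatedBy E y₀ xₙ₋₁ (stays (inj₂ y₀) (λ ()) y₀∈S)
                              (stays (inj₁ xₙ₋₁) (xₙ₋₁≢xₙ ∘ inj₁-injective) xₙ₋₁∈S)
          (λ x _ → y₀-universal x)
          (λ y y∉S' → xₙ₋₁-adjacent y (swap-∉⇒≢new E S (inj₁ xₙ) (inj₂ y⋆) y∉S' ∘ cong inj₂))
        where stays = swap-∈-old E S (inj₁ xₙ) (inj₂ y⋆)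
      ... | inj₂ refl with y₂-spec
      ...   | y₂ , y₂≢y₀ , y₂≢y₁ , xₙ₋₁~y₂ =
        inj₂ y₂ , xₙ₋₁~y₂ , ∉S y₂≢y₀ y₂≢y₁ ,
        dominatedBy E y₀ xₙ (stays (inj₂ y₀) (λ ()) y₀∈S)
                            (stays (inj₁ xₙ) (xₙ₋₁≢xₙ ∘ sym ∘ inj₁-injective) xₙ∈S)
          (λ x _ → y₀-universal x) (λ y _ → xₙ-universal y)
        where stays = swap-∈-old E S (inj₁ xₙ₋₁) (inj₂ y₂)
      cs (inj₂ y) y∈S with S∩Y y∈S
      ... | inj₁ refl =
        inj₁ x₀ , y₀-universal x₀ , ∉S x₀≢xₙ x₀≢xₙ₋₁ ,
        dominatedBy E y₁ xₙ (stays (inj₂ y₁) (y₁≢y₀ ∘ inj₂-injective) y₁∈S) (stays (inj₁ xₙ) (λ ()) xₙ∈S)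
          (λ x x∉S' → y₁-adjacent x (swap-∉⇒≢new E S (inj₂ y₀) (inj₁ x₀) x∉S' ∘ cong inj₁))
          (λ y _ → xₙ-universal y)
        where stays = swap-∈-old E S (inj₂ y₀) (inj₁ x₀)
      ... | inj₂ refl =
        inj₁ x₁ , proj₂ (proj₂ y₁-spec) , ∉S x₁≢xₙ x₁≢xₙ₋₁ ,
        dominatedBy E y₀ xₙ (stays (inj₂ y₀) (y₁≢y₀ ∘ sym ∘ inj₂-injective) y₀∈S)
                            (stays (inj₁ xₙ) (λ ()) xₙ∈S)
          (λ x _ → y₀-universal x) (λ y _ → xₙ-universal y)
        where stays = swap-∈-old E S (inj₂ y₁) (inj₁ x₁)

mainTheorem17 : (p q : ℕ) (E : Fin p → Fin q → Bool) →
    IsChainGraph E → Connected E → 3 ≤ numClasses E →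
    AtMostOnePendentX E → AtMostOnePendentY E →
    ((p ≡ 3 ⊎ q ≡ 3) → GammaCSIs E 3) ×
    (¬ p ≡ 3 → ¬ q ≡ 3 → GammaCSIs E 4)
mainTheorem17 zero _ E _ _ 3≤k _ _ with 3≤numClasses⇒3≤p E 3≤k
... | ()
mainTheorem17 (suc zero) _ E _ _ 3≤k _ _ with 3≤numClasses⇒3≤p E 3≤k
... | s≤s ()
mainTheorem17 (suc (suc r)) q E chain connected 3≤k pX pY = γ≡3 , γ≡4
  where
  open ChainGraph E chain connected pX
  three : ThreeNeighbourhoods E
  three = 3≤numClasses⇒threeNeighbourhoods E 3≤k
  3≤p : 3 ≤ 2 + r
  3≤p = threeNeighbourhoods⇒3≤p E three
  3≤q : 3 ≤ q
  3≤q = threeNeighbourhoods⇒3≤q E y₀-universal y₁≢y₀ three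

  γ≡3 : (2 + r ≡ 3 ⊎ q ≡ 3) → GammaCSIs E 3
  γ≡3 p≡3⊎q≡3 = upper p≡3⊎q≡3 , λ _ → cosecure⇒size≥ E 3≤p 3≤q (n≤1+n 3)
    where
    upper : (2 + r ≡ 3 ⊎ q ≡ 3) → ∃ λ S → CosecureDominating E S × size E S ≡ 3
    upper (inj₁ p≡3) with cosecureOfSizeP E noIsolatedX noIsolatedY pY
    ... | S , cs , size≡p = S , cs , trans size≡p p≡3
    upper (inj₂ q≡3) with cosecureOfSizeQ E noIsolatedX noIsolatedY pX
    ... | S , cs , size≡q = S , cs , trans size≡q q≡3

  γ≡4 : ¬ 2 + r ≡ 3 → ¬ q ≡ 3 → GammaCSIs E 4
  γ≡4 p≢3 q≢3 = (S , S-cosecure , size-S) , λ _ → cosecure⇒size≥ E 4≤p 4≤q ≤-refl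
    where
    4≤p : 4 ≤ 2 + r
    4≤p = ≤∧≢⇒< 3≤p (p≢3 ∘ sym)
    4≤q : 4 ≤ q
    4≤q = ≤∧≢⇒< 3≤q (q≢3 ∘ sym)
    open SizeFour (s≤s⁻¹ (s≤s⁻¹ 4≤p)) 4≤q pY
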